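{- Let $A$ be an MV-algebra with lattice spectrum $X$ and map $k\colon X\to Y$ as in the context. For all $a,u\in A$, $$\hat a\cap k^{ -1}(X\setminus\hat u)\ \subseteq\ \bigcap_{m=0}^\infty \widehat{a\ominus mu}\ \subseteq\ \hat a\cap{\downarrow}k^{ -1}(X\setminus\hat u),$$ where ${\downarrow}S:=\{x\in X:\exists s\in S,\ x\le s\}$.
   Context: MV-algebra $(A,\oplus,\neg,0)$: $(A,\oplus,0)$ commutative monoid, $\neg\neg x=x$, $x\oplus\neg0=\neg0$, $\neg(\neg x\oplus y)\oplus y=\neg(\neg y\oplus x)\oplus x$; $x\ominus y:=\neg(\neg x\oplus y)$; $mu$ is the $m$-fold sum $u\oplus\cdots\oplus u$ ($0u:=0$); lattice operations $x\vee y:=\neg(\neg x\oplus y)\oplus y$, $x\wedge y:=\neg(\neg x\vee\neg y)$. MV-ideal: downset containing $0$ closed under $\oplus$; prime if proper and for all $a,b$, $a\ominus b$ or $b\ominus a$ lies in it. $X$: set of prime lattice ideals of the lattice reduct, $I_x$ the ideal of $x$, $x\le x'$ iff $I_x\subseteq I_{x'}$, $\hat a:=\{x\in X:a\notin I_x\}$. $Y\subseteq X$: points whose ideals are prime MV-ideals. $I\,\overline{\oplus}\,J:=\{c:\exists a\in I,b\in J,\ c\le a\oplus b\}$. $k\colon X\to Y$: $I_{k(x)}$ is the largest lattice ideal $J$ with $I_x\,\overline{\oplus}\,J\subseteq I_x$ (exists, and is a prime MV-ideal). Thus $k^{ -1}(X\setminus\hat u)=\{x\in X: u\in I_{k(x)}\}$.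 -}

module Defs where

open import Level using (0ℓ)
open import Data.Nat using (ℕ; zero; suc)
open import Data.Product using (Σ; ∃; ∃-syntax; _×_; _,_; proj₁)
open import Data.Sum using (_⊎_)
open import Relation.Nullary using (¬_)
open import Relation.Binary.PropositionalEquality using (_≡_)

record MVAlgebra : Set₁ where
  infixl 6 _⊕_
  field
    Carrier  : Set
    _⊕_      : Carrier → Carrier → Carrier
    neg      : Carrier → Carrier
    zer      : Carrier
    ⊕-assoc  : ∀ x y z → (x ⊕ y) ⊕ z ≡ x ⊕ (y ⊕ z)
    ⊕-comm   : ∀ x y → x ⊕ y ≡ y ⊕ x
    ⊕-idʳ    : ∀ x → x ⊕ zer ≡ x
    neg-inv  : ∀ x → neg (neg x) ≡ x
    ⊕-absorb : ∀ x → x ⊕ neg zer ≡ neg zer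
    luk      : ∀ x y → neg (neg x ⊕ y) ⊕ y ≡ neg (neg y ⊕ x) ⊕ x

  one : Carrier
  one = neg zer

  _⊖_ : Carrier → Carrier → Carrier
  x ⊖ y = neg (neg x ⊕ y)

  _·_ : ℕ → Carrier → Carrier
  zero  · u = zer
  suc m · u = (m · u) ⊕ u

  _∨_ : Carrier → Carrier → Carrier
  x ∨ y = neg (neg x ⊕ y) ⊕ y

  _∧_ : Carrier → Carrier → Carrier
  x ∧ y = neg (neg x ∨ neg y)

  _≤_ : Carrier → Carrier → Set
  x ≤ y = (x ∨ y) ≡ y

  Sub : Set₁
  Sub = Carrier → Set

  _⊆_ : Sub → Sub → Set
  I ⊆ J = ∀ a → I a → J a

  record IsLatticeIdeal (I : Sub) : Set where
    field
      nonempty : ∃[ a ] I a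
      downward : ∀ a b → a ≤ b → I b → I a
      ∨-closed : ∀ a b → I a → I b → I (a ∨ b)

  record IsPrimeLatticeIdeal (I : Sub) : Set where
    field
      isLatticeIdeal : IsLatticeIdeal I
      proper         : ∃[ a ] ¬ I a
      prime          : ∀ a b → I (a ∧ b) → I a ⊎ I b

  X : Set₁
  X = Σ Sub IsPrimeLatticeIdeal

  Ix : X → Sub
  Ix = proj₁

  _≤X_ : X → X → Set
  x ≤X x' = Ix x ⊆ Ix x'

  hat : Carrier → X → Set
  hat a x = ¬ Ix x a

  _⊕̄_ : Sub → Sub → Sub
  (I ⊕̄ J) c = ∃[ a ] ∃[ b ] (I a × J b × c ≤ (a ⊕ b))

  record IsLargestAbsorbed (I K : Sub) : Set₁ where
    field
      K-ideal    : IsLatticeIdeal K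
      K-absorbed : (I ⊕̄ K) ⊆ I
      K-largest  : ∀ (J : Sub) → IsLatticeIdeal J → (I ⊕̄ J) ⊆ I → J ⊆ K

  -- a map k : X → Y, given by its ideals I_{k(x)}, as in the context
  IsK : (X → Sub) → Set₁
  IsK kI = ∀ x → IsLargestAbsorbed (Ix x) (kI x)

  -- k⁻¹(X ∖ û) = { x : u ∈ I_{k(x)} }
  kPreCompl : (X → Sub) → Carrier → X → Set
  kPreCompl kI u x = kI x u

  down : (X → Set) → X → Set₁
  down S x = Σ X (λ s → S s × x ≤X s)

-- If u ∈ I_{k(x)} then I_x absorbs u, and a ⊖ m u ≤ (a ⊖ (m + 1) u) ⊕ u; so a ⊖ m u ∈ I_x
-- for some m would push a back into I_x.  Conversely, if no a ⊖ m u lies in I_x, the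
-- u-saturation S = {c : c ⊖ m u ∈ I_x for some m} is a prime lattice ideal above I_x, missing a,
-- with S ⊕̄ ↓u ⊆ S; maximality of I_{k(s)} then gives u ∈ I_{k(s)} for the point s of S.
-- Primality of S comes from (c ⊖ t) ∧ (d ⊖ t) ≤ (c ∧ d) ⊖ t, a consequence of prelinearity.
module Submission where

open import Defs
open import Data.Nat using (ℕ; zero; suc; _+_)
open import Data.Nat.Properties using (+-comm)
open import Data.Product using (_×_; _,_; proj₂; ∃-syntax)
open import Data.Sum using (map)
open import Relation.Nullary using (¬_)
open import Function using (_∘′_)
open import Relation.Binary.PropositionalEquality
open import Algebra.Bundles using (CommutativeMonoid)
import Algebra.Solver.CommutativeMonoid as CommutativeMonoidSolver

module Properties (A : MVAlgebra) where
  open MVAlgebra A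
  open ≡-Reasoning

  ⊕-identityˡ : ∀ x → zer ⊕ x ≡ x
  ⊕-identityˡ x = trans (⊕-comm zer x) (⊕-idʳ x)

  ⊕-commutativeMonoid : CommutativeMonoid _ _
  ⊕-commutativeMonoid = record
    { Carrier = Carrier ; _≈_ = _≡_ ; _∙_ = _⊕_ ; ε = zer
    ; isCommutativeMonoid = record
      { isMonoid = record
        { isSemigroup = record
          { isMagma = record { isEquivalence = isEquivalence ; ∙-cong = cong₂ _⊕_ }
          ; assoc = ⊕-assoc }
        ; identity = ⊕-identityˡ , ⊕-idʳ }
      ; comm = ⊕-comm } }

  open CommutativeMonoidSolver ⊕-commutativeMonoid using (solve; _⊜_) renaming (_⊕_ to _⊞_)

  -- The lattice order, in the form ¬x ⊕ y = 1 that interacts directly with ⊕.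
  infix 4 _≼_
  _≼_ : Carrier → Carrier → Set
  x ≼ y = neg x ⊕ y ≡ one

  neg-one : neg one ≡ zer
  neg-one = neg-inv zer

  ⊕-zeroˡ : ∀ x → one ⊕ x ≡ one
  ⊕-zeroˡ x = trans (⊕-comm one x) (⊕-absorb x)

  neg-inverseˡ : ∀ x → neg x ⊕ x ≡ one
  neg-inverseˡ x = begin
    neg x ⊕ x              ≡⟨ cong (λ z → neg z ⊕ x) (sym (⊕-identityˡ x)) ⟩
    neg (zer ⊕ x) ⊕ x      ≡⟨ cong (λ z → neg (z ⊕ x) ⊕ x) (sym neg-one) ⟩
    neg (neg one ⊕ x) ⊕ x  ≡⟨ luk one x ⟩
    neg (neg x ⊕ one) ⊕ one ≡⟨ ⊕-absorb _ ⟩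
    one                    ∎

  neg-inverseʳ : ∀ x → x ⊕ neg x ≡ one
  neg-inverseʳ x = trans (⊕-comm x (neg x)) (neg-inverseˡ x)

  ⊖-identityʳ : ∀ x → x ⊖ zer ≡ x
  ⊖-identityʳ x = trans (cong neg (⊕-idʳ (neg x))) (neg-inv x)

  ≼-refl : ∀ x → x ≼ x
  ≼-refl = neg-inverseˡ

  ≼⇒⊖-⊕-cancel : ∀ {x y} → x ≼ y → (y ⊖ x) ⊕ x ≡ y
  ≼⇒⊖-⊕-cancel {x} {y} x≼y = begin
    neg (neg y ⊕ x) ⊕ x ≡⟨ sym (luk x y) ⟩
    neg (neg x ⊕ y) ⊕ y ≡⟨ cong (λ z → neg z ⊕ y) x≼y ⟩
    neg one ⊕ y         ≡⟨ cong (_⊕ y) neg-one ⟩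
    zer ⊕ y             ≡⟨ ⊕-identityˡ y ⟩
    y                   ∎

  x≼x⊕y : ∀ x y → x ≼ x ⊕ y
  x≼x⊕y x y = trans (sym (⊕-assoc (neg x) x y)) (trans (cong (_⊕ y) (neg-inverseˡ x)) (⊕-zeroˡ y))

  ⊕≡⇒≼ : ∀ {x y} z → x ⊕ z ≡ y → x ≼ y
  ⊕≡⇒≼ {x} z x⊕z≡y = subst (x ≼_) x⊕z≡y (x≼x⊕y x z)

  ≼-trans : ∀ {x y z} → x ≼ y → y ≼ z → x ≼ z
  ≼-trans {x} {y} {z} x≼y y≼z = ⊕≡⇒≼ ((z ⊖ y) ⊕ (y ⊖ x)) (begin
    x ⊕ ((z ⊖ y) ⊕ (y ⊖ x)) ≡⟨ solve 3 (λ a b c → a ⊞ (b ⊞ c) ⊜ b ⊞ (c ⊞ a)) refl x (z ⊖ y) (y ⊖ x) ⟩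
    (z ⊖ y) ⊕ ((y ⊖ x) ⊕ x) ≡⟨ cong ((z ⊖ y) ⊕_) (≼⇒⊖-⊕-cancel x≼y) ⟩
    (z ⊖ y) ⊕ y             ≡⟨ ≼⇒⊖-⊕-cancel y≼z ⟩
    z                       ∎)

  ≤⇒≼ : ∀ {x y} → x ≤ y → x ≼ y
  ≤⇒≼ {x} {y} x≤y = begin
    neg x ⊕ y                      ≡⟨ cong (neg x ⊕_) (sym x≤y) ⟩
    neg x ⊕ (neg (neg x ⊕ y) ⊕ y)  ≡⟨ solve 3 (λ a w b → a ⊞ (w ⊞ b) ⊜ (a ⊞ b) ⊞ w) refl (neg x) (neg (neg x ⊕ y)) y ⟩
    (neg x ⊕ y) ⊕ neg (neg x ⊕ y)  ≡⟨ neg-inverseʳ _ ⟩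
    one                            ∎

  ≼⇒≤ : ∀ {x y} → x ≼ y → x ≤ y
  ≼⇒≤ {x} {y} x≼y = trans (cong (λ z → neg z ⊕ y) x≼y) (trans (cong (_⊕ y) neg-one) (⊕-identityˡ y))

  ⊕-monoˡ-≼ : ∀ {x y} t → x ≼ y → x ⊕ t ≼ y ⊕ t
  ⊕-monoˡ-≼ {x} {y} t x≼y = ⊕≡⇒≼ (y ⊖ x)
    (trans (solve 3 (λ a b c → (a ⊞ b) ⊞ c ⊜ (c ⊞ a) ⊞ b) refl x t (y ⊖ x))
           (cong (_⊕ t) (≼⇒⊖-⊕-cancel x≼y)))

  ⊕-monoʳ-≼ : ∀ {x y} t → x ≼ y → t ⊕ x ≼ t ⊕ y
  ⊕-monoʳ-≼ {x} {y} t x≼y = subst₂ _≼_ (⊕-comm x t) (⊕-comm y t) (⊕-monoˡ-≼ t x≼y)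

  neg-antitone-≼ : ∀ {x y} → x ≼ y → neg y ≼ neg x
  neg-antitone-≼ {x} {y} x≼y = trans (cong (_⊕ neg x) (neg-inv y)) (trans (⊕-comm y (neg x)) x≼y)

  -- Residuation: ⊖ t is left adjoint to ⊕ t; both sides are literally the same element.
  neg-⊖-⊕ : ∀ x t b → neg (x ⊖ t) ⊕ b ≡ neg x ⊕ (b ⊕ t)
  neg-⊖-⊕ x t b = trans (cong (_⊕ b) (neg-inv _))
    (solve 3 (λ a c d → (a ⊞ c) ⊞ d ⊜ a ⊞ (d ⊞ c)) refl (neg x) t b)

  ⊖-≼⇒≼-⊕ : ∀ {x t b} → x ⊖ t ≼ b → x ≼ b ⊕ t
  ⊖-≼⇒≼-⊕ {x} {t} {b} = trans (sym (neg-⊖-⊕ x t b))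

  ≼-⊕⇒⊖-≼ : ∀ {x t b} → x ≼ b ⊕ t → x ⊖ t ≼ b
  ≼-⊕⇒⊖-≼ {x} {t} {b} = trans (neg-⊖-⊕ x t b)

  x≼[x⊖t]⊕t : ∀ {x t} → x ≼ (x ⊖ t) ⊕ t
  x≼[x⊖t]⊕t {x} {t} = ⊕≡⇒≼ (t ⊖ x) (trans (⊕-comm x (t ⊖ x)) (sym (luk x t)))

  x⊖t≼x : ∀ {x t} → x ⊖ t ≼ x
  x⊖t≼x {x} {t} = ≼-⊕⇒⊖-≼ (x≼x⊕y x t)

  ⊖-monoˡ-≼ : ∀ {x y t} → x ≼ y → x ⊖ t ≼ y ⊖ t
  ⊖-monoˡ-≼ x≼y = ≼-⊕⇒⊖-≼ (≼-trans x≼y x≼[x⊖t]⊕t)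

  ⊖-antitoneʳ-≼ : ∀ {x t t′} → t ≼ t′ → x ⊖ t′ ≼ x ⊖ t
  ⊖-antitoneʳ-≼ {x} {t} {t′} t≼t′ = ≼-⊕⇒⊖-≼ (≼-trans x≼[x⊖t]⊕t (⊕-monoʳ-≼ (x ⊖ t) t≼t′))

  ⊖-sub-⊕ : ∀ x s t → (x ⊖ s) ⊖ t ≡ neg ((neg x ⊕ s) ⊕ t)
  ⊖-sub-⊕ x s t = cong (λ z → neg (z ⊕ t)) (neg-inv _)

  ⊖-swap : ∀ x s t → (x ⊖ s) ⊖ t ≡ (x ⊖ t) ⊖ s
  ⊖-swap x s t = begin
    (x ⊖ s) ⊖ t            ≡⟨ ⊖-sub-⊕ x s t ⟩
    neg ((neg x ⊕ s) ⊕ t)  ≡⟨ cong neg (solve 3 (λ n c e → (n ⊞ c) ⊞ e ⊜ (n ⊞ e) ⊞ c) refl (neg x) s t) ⟩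
    neg ((neg x ⊕ t) ⊕ s)  ≡⟨ sym (⊖-sub-⊕ x t s) ⟩
    (x ⊖ t) ⊖ s            ∎

  x≼x∨y : ∀ {x y} → x ≼ x ∨ y
  x≼x∨y {x} {y} = ⊕≡⇒≼ (y ⊖ x) (trans (⊕-comm x (y ⊖ x)) (sym (luk x y)))

  y≼x∨y : ∀ {x y} → y ≼ x ∨ y
  y≼x∨y {x} {y} = ⊕≡⇒≼ (x ⊖ y) (⊕-comm y (x ⊖ y))

  ∨-lub : ∀ {x y z} → x ≼ z → y ≼ z → x ∨ y ≼ z
  ∨-lub {x} {y} {z} x≼z y≼z = begin
    neg (P ⊕ y) ⊕ z                       ≡⟨ cong (neg (P ⊕ y) ⊕_) (sym (≼⇒⊖-⊕-cancel y≼z)) ⟩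
    neg (P ⊕ y) ⊕ ((z ⊖ y) ⊕ y)           ≡⟨ solve 3 (λ a b c → a ⊞ (b ⊞ c) ⊜ (a ⊞ c) ⊞ b) refl (neg (P ⊕ y)) (z ⊖ y) y ⟩
    (neg (P ⊕ y) ⊕ y) ⊕ (z ⊖ y)           ≡⟨ cong (λ w → (neg (w ⊕ y) ⊕ y) ⊕ (z ⊖ y)) (sym (neg-inv P)) ⟩
    (neg (neg (neg P) ⊕ y) ⊕ y) ⊕ (z ⊖ y) ≡⟨ cong (_⊕ (z ⊖ y)) (luk (neg P) y) ⟩
    (W ⊕ neg P) ⊕ (z ⊖ y)                 ≡⟨ ⊕-assoc W (neg P) (z ⊖ y) ⟩
    W ⊕ (neg P ⊕ (z ⊖ y))                 ≡⟨ cong (λ w → W ⊕ (w ⊕ (z ⊖ y))) (neg-inv _) ⟩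
    W ⊕ ((neg x ⊕ y) ⊕ (z ⊖ y))           ≡⟨ cong (W ⊕_) (solve 3 (λ a b c → (a ⊞ b) ⊞ c ⊜ a ⊞ (c ⊞ b)) refl (neg x) y (z ⊖ y)) ⟩
    W ⊕ (neg x ⊕ ((z ⊖ y) ⊕ y))           ≡⟨ cong (λ w → W ⊕ (neg x ⊕ w)) (≼⇒⊖-⊕-cancel y≼z) ⟩
    W ⊕ (neg x ⊕ z)                       ≡⟨ cong (W ⊕_) x≼z ⟩
    W ⊕ one                               ≡⟨ ⊕-absorb W ⟩
    one                                   ∎
    where
    P = x ⊖ y
    W = neg (neg y ⊕ neg P)

  x∧y≼x : ∀ {x y} → x ∧ y ≼ x
  x∧y≼x {x} {y} = subst (x ∧ y ≼_) (neg-inv x) (neg-antitone-≼ (x≼x∨y {neg x} {neg y}))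

  x∧y≼y : ∀ {x y} → x ∧ y ≼ y
  x∧y≼y {x} {y} = subst (x ∧ y ≼_) (neg-inv y) (neg-antitone-≼ (y≼x∨y {neg x} {neg y}))

  ∧-glb : ∀ {x y z} → z ≼ x → z ≼ y → z ≼ x ∧ y
  ∧-glb {x} {y} {z} z≼x z≼y =
    subst (_≼ x ∧ y) (neg-inv z) (neg-antitone-≼ (∨-lub (neg-antitone-≼ z≼x) (neg-antitone-≼ z≼y)))

  ∨-⊖-≼ : ∀ {c d t} → (c ∨ d) ⊖ t ≼ (c ⊖ t) ∨ (d ⊖ t)
  ∨-⊖-≼ = ≼-⊕⇒⊖-≼ (∨-lub (≼-trans x≼[x⊖t]⊕t (⊕-monoˡ-≼ _ x≼x∨y))
                          (≼-trans x≼[x⊖t]⊕t (⊕-monoˡ-≼ _ y≼x∨y)))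

  ⊖-∧-≼ : ∀ {g p q} → g ⊖ (p ∧ q) ≼ (g ⊖ p) ∨ (g ⊖ q)
  ⊖-∧-≼ {g} {p} {q} = ≼-⊕⇒⊖-≼ (≼-trans g≼h h≼w⊕[p∧q])
    where
    w = (g ⊖ p) ∨ (g ⊖ q)
    h = (w ⊕ p) ∧ (w ⊕ q)
    g≼h : g ≼ h
    g≼h = ∧-glb (⊖-≼⇒≼-⊕ x≼x∨y) (⊖-≼⇒≼-⊕ y≼x∨y)
    h⊖w≼p : h ⊖ w ≼ p
    h⊖w≼p = ≼-⊕⇒⊖-≼ (subst (h ≼_) (⊕-comm w p) x∧y≼x)
    h⊖w≼q : h ⊖ w ≼ q
    h⊖w≼q = ≼-⊕⇒⊖-≼ (subst (h ≼_) (⊕-comm w q) x∧y≼y)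
    h≼w⊕[p∧q] : h ≼ w ⊕ (p ∧ q)
    h≼w⊕[p∧q] = subst (h ≼_) (⊕-comm (p ∧ q) w) (⊖-≼⇒≼-⊕ (∧-glb h⊖w≼p h⊖w≼q))

  -- x ⊖ (x ⊖ y) is the meet of x and y, written symmetrically.
  ⊖-⊖-comm : ∀ x y → y ⊖ (y ⊖ x) ≡ x ⊖ (x ⊖ y)
  ⊖-⊖-comm x y = cong neg (begin
    neg y ⊕ neg (neg y ⊕ x)             ≡⟨ ⊕-comm _ _ ⟩
    neg (neg y ⊕ x) ⊕ neg y             ≡⟨ cong (λ w → neg w ⊕ neg y) (trans (⊕-comm (neg y) x) (cong (_⊕ neg y) (sym (neg-inv x)))) ⟩
    neg (neg (neg x) ⊕ neg y) ⊕ neg y   ≡⟨ luk (neg x) (neg y) ⟩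
    neg (neg (neg y) ⊕ neg x) ⊕ neg x   ≡⟨ cong (λ w → neg w ⊕ neg x) (trans (cong (_⊕ neg x) (neg-inv y)) (⊕-comm y (neg x))) ⟩
    neg (neg x ⊕ y) ⊕ neg x             ≡⟨ ⊕-comm _ _ ⟩
    neg x ⊕ neg (neg x ⊕ y)             ∎)

  x⊖[x⊖y]≼y : ∀ {x y} → x ⊖ (x ⊖ y) ≼ y
  x⊖[x⊖y]≼y {x} {y} = subst (_≼ y) (⊖-⊖-comm x y) x⊖t≼x

  neg-⊕-⊖-⊖ : ∀ x y → neg x ⊕ (x ⊖ (x ⊖ y)) ≡ neg x ⊕ y
  neg-⊕-⊖-⊖ x y = begin
    neg x ⊕ neg (neg x ⊕ e)              ≡⟨ ⊕-comm _ _ ⟩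
    neg (neg x ⊕ e) ⊕ neg x              ≡⟨ cong (λ w → neg w ⊕ neg x) (trans (⊕-comm (neg x) e) (cong (_⊕ neg x) (sym (neg-inv e)))) ⟩
    neg (neg (neg e) ⊕ neg x) ⊕ neg x    ≡⟨ luk (neg e) (neg x) ⟩
    neg (neg (neg x) ⊕ neg e) ⊕ neg e    ≡⟨ cong (λ w → neg (w ⊕ neg e) ⊕ neg e) (neg-inv x) ⟩
    neg (x ⊕ neg e) ⊕ neg e              ≡⟨ cong (λ w → neg (x ⊕ w) ⊕ w) (neg-inv _) ⟩
    neg (x ⊕ (neg x ⊕ y)) ⊕ (neg x ⊕ y)  ≡⟨ cong (λ w → neg w ⊕ (neg x ⊕ y)) x⊕[neg-x⊕y]≡one ⟩
    neg one ⊕ (neg x ⊕ y)                ≡⟨ cong (_⊕ (neg x ⊕ y)) neg-one ⟩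
    zer ⊕ (neg x ⊕ y)                    ≡⟨ ⊕-identityˡ _ ⟩
    neg x ⊕ y                            ∎
    where
    e = x ⊖ y
    x⊕[neg-x⊕y]≡one : x ⊕ (neg x ⊕ y) ≡ one
    x⊕[neg-x⊕y]≡one = trans (sym (⊕-assoc x (neg x) y)) (trans (cong (_⊕ y) (neg-inverseʳ x)) (⊕-zeroˡ y))

  neg-⊕-absorbs-⊖ : ∀ x y → (neg x ⊕ y) ⊕ (y ⊖ x) ≡ neg x ⊕ y
  neg-⊕-absorbs-⊖ x y = sym (begin
    neg x ⊕ y                     ≡⟨ cong (neg x ⊕_) (sym (≼⇒⊖-⊕-cancel (x⊖t≼x {y} {x}))) ⟩
    neg x ⊕ (m ⊕ d)               ≡⟨ sym (⊕-assoc (neg x) m d) ⟩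
    (neg x ⊕ m) ⊕ d               ≡⟨ cong (λ w → (neg x ⊕ w) ⊕ d) (⊖-⊖-comm x y) ⟩
    (neg x ⊕ (x ⊖ (x ⊖ y))) ⊕ d   ≡⟨ cong (_⊕ d) (neg-⊕-⊖-⊖ x y) ⟩
    (neg x ⊕ y) ⊕ d               ∎)
    where
    d = y ⊖ x
    m = y ⊖ d

  prelinearity : ∀ c d → (c ⊖ d) ∧ (d ⊖ c) ≼ zer
  prelinearity c d = trans (⊕-idʳ _) neg-Z≡one
    where
    P = c ⊖ d
    Q = d ⊖ c
    Z = P ∧ Q
    P⊕neg-Q : P ⊕ neg Q ≡ neg Q
    P⊕neg-Q = trans (cong (P ⊕_) (neg-inv _))
      (trans (⊕-comm P _) (trans (neg-⊕-absorbs-⊖ d c) (sym (neg-inv _))))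
    neg-P∨neg-Q : neg P ∨ neg Q ≡ one
    neg-P∨neg-Q = trans (cong (λ w → neg (w ⊕ neg Q) ⊕ neg Q) (neg-inv P))
      (trans (cong (λ w → neg w ⊕ neg Q) P⊕neg-Q) (neg-inverseˡ (neg Q)))
    one≼neg-Z : neg P ∨ neg Q ≼ neg Z
    one≼neg-Z = ∨-lub (neg-antitone-≼ x∧y≼x) (neg-antitone-≼ x∧y≼y)
    neg-Z≡one : neg Z ≡ one
    neg-Z≡one = trans (sym (⊕-identityˡ (neg Z)))
      (trans (cong (_⊕ neg Z) (sym neg-one)) (trans (cong (λ w → neg w ⊕ neg Z) (sym neg-P∨neg-Q)) one≼neg-Z))

  -- Split along the prelinear pair c ⊖ d, d ⊖ c, whose meet is 0: on either piece
  -- (c ⊖ t) ∧ (d ⊖ t) falls below (c ∧ d) ⊖ t, with c ∧ d = c ⊖ (c ⊖ d) = d ⊖ (d ⊖ c).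
  ∧-⊖-≼ : ∀ {c d t} → (c ⊖ t) ∧ (d ⊖ t) ≼ (c ∧ d) ⊖ t
  ∧-⊖-≼ {c} {d} {t} = ≼-trans g≼g⊖[P∧Q] (≼-trans ⊖-∧-≼ (∨-lub g⊖P≼ g⊖Q≼))
    where
    g = (c ⊖ t) ∧ (d ⊖ t)
    P = c ⊖ d
    Q = d ⊖ c
    g≼g⊖[P∧Q] : g ≼ g ⊖ (P ∧ Q)
    g≼g⊖[P∧Q] = subst (_≼ g ⊖ (P ∧ Q)) (⊖-identityʳ g) (⊖-antitoneʳ-≼ (prelinearity c d))
    g⊖P≼ : g ⊖ P ≼ (c ∧ d) ⊖ t
    g⊖P≼ = ≼-trans (⊖-monoˡ-≼ x∧y≼x)
      (subst (_≼ (c ∧ d) ⊖ t) (sym (⊖-swap c t P)) (⊖-monoˡ-≼ (∧-glb x⊖t≼x x⊖[x⊖y]≼y)))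
    g⊖Q≼ : g ⊖ Q ≼ (c ∧ d) ⊖ t
    g⊖Q≼ = ≼-trans (⊖-monoˡ-≼ x∧y≼y)
      (subst (_≼ (c ∧ d) ⊖ t) (sym (⊖-swap d t Q)) (⊖-monoˡ-≼ (∧-glb x⊖[x⊖y]≼y x⊖t≼x)))

  ⊖-suc-· : ∀ x m u → x ⊖ (suc m · u) ≡ (x ⊖ (m · u)) ⊖ u
  ⊖-suc-· x m u = trans (cong neg (sym (⊕-assoc (neg x) (m · u) u))) (sym (⊖-sub-⊕ x (m · u) u))

  ·-≼-+ˡ : ∀ k m u → m · u ≼ (k + m) · u
  ·-≼-+ˡ zero    m u = ≼-refl _
  ·-≼-+ˡ (suc k) m u = ≼-trans (·-≼-+ˡ k m u) (x≼x⊕y _ u)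

  ·-≼-+ʳ : ∀ k m u → m · u ≼ (m + k) · u
  ·-≼-+ʳ k m u = subst (λ n → m · u ≼ n · u) (+-comm k m) (·-≼-+ˡ k m u)

  ideal-≼-closed : ∀ {I} → IsLatticeIdeal I → ∀ {c c′} → I c → c′ ≼ c → I c′
  ideal-≼-closed isI {c} {c′} c∈I c′≼c = IsLatticeIdeal.downward isI c′ c (≼⇒≤ c′≼c) c∈I

  ideal-zer : ∀ {I} → IsLatticeIdeal I → I zer
  ideal-zer isI = ideal-≼-closed isI (proj₂ (IsLatticeIdeal.nonempty isI)) (⊕-zeroˡ _)

  principal-isLatticeIdeal : ∀ u → IsLatticeIdeal (_≼ u)
  principal-isLatticeIdeal u = record
    { nonempty = u , ≼-refl u
    ; downward = λ c d c≤d d≼u → ≼-trans (≤⇒≼ c≤d) d≼u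
    ; ∨-closed = λ c d → ∨-lub }

  absorbed-⊖-· : ∀ {I K u} → (I ⊕̄ K) ⊆ I → K u → ∀ {x} m → I (x ⊖ (m · u)) → I x
  absorbed-⊖-· {I} {K} {u} absorbs u∈K {x} zero    x⊖0∈I = subst I (⊖-identityʳ x) x⊖0∈I
  absorbed-⊖-· {I} {K} {u} absorbs u∈K {x} (suc m) x⊖m+1∈I =
    absorbed-⊖-· absorbs u∈K m
      (absorbs (x ⊖ (m · u)) (_ , u , subst I (⊖-suc-· x m u) x⊖m+1∈I , u∈K , ≼⇒≤ x≼[x⊖t]⊕t))

module Saturation (A : MVAlgebra) (u : MVAlgebra.Carrier A) where
  open MVAlgebra A
  open Properties A

  saturate : Sub → Sub
  saturate I c = ∃[ m ] I (c ⊖ (m · u))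

  ⊆-saturate : ∀ I → I ⊆ saturate I
  ⊆-saturate I c c∈I = 0 , subst I (sym (⊖-identityʳ c)) c∈I

  saturate-isLatticeIdeal : ∀ {I} → IsLatticeIdeal I → IsLatticeIdeal (saturate I)
  saturate-isLatticeIdeal {I} isI = record
    { nonempty = zer , ⊆-saturate I zer (ideal-zer isI)
    ; downward = λ c d c≤d → λ { (m , d∈) → m , ideal-≼-closed isI d∈ (⊖-monoˡ-≼ (≤⇒≼ c≤d)) }
    ; ∨-closed = λ c d → λ { (m , c∈) (n , d∈) →
        n + m , ideal-≼-closed isI
                  (IsLatticeIdeal.∨-closed isI _ _
                    (ideal-≼-closed isI c∈ (⊖-antitoneʳ-≼ (·-≼-+ˡ n m u)))
                    (ideal-≼-closed isI d∈ (⊖-antitoneʳ-≼ (·-≼-+ʳ m n u))))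
                  ∨-⊖-≼ } }

  saturate-isPrime : ∀ {I} → IsPrimeLatticeIdeal I → ∀ a → ¬ saturate I a →
                     IsPrimeLatticeIdeal (saturate I)
  saturate-isPrime {I} isP a a∉ = record
    { isLatticeIdeal = saturate-isLatticeIdeal isI
    ; proper = a , a∉
    ; prime = λ c d → λ { (m , c∧d∈) →
        map (m ,_) (m ,_) (IsPrimeLatticeIdeal.prime isP _ _ (ideal-≼-closed isI c∧d∈ ∧-⊖-≼)) } }
    where
    isI = IsPrimeLatticeIdeal.isLatticeIdeal isP

  saturate-absorbs-principal : ∀ {I} → IsLatticeIdeal I → (saturate I ⊕̄ (_≼ u)) ⊆ saturate I
  saturate-absorbs-principal {I} isI c (b , j , (m , b∈) , j≼u , c≤b⊕j) =
    suc m , subst I (sym (⊖-suc-· c m u)) (subst I (⊖-swap c u (m · u)) c⊖u⊖mu∈I)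
    where
    c⊖u≼b : c ⊖ u ≼ b
    c⊖u≼b = ≼-⊕⇒⊖-≼ (≼-trans (≤⇒≼ c≤b⊕j) (⊕-monoʳ-≼ b j≼u))
    c⊖u⊖mu∈I : I ((c ⊖ u) ⊖ (m · u))
    c⊖u⊖mu∈I = ideal-≼-closed isI b∈ (⊖-monoˡ-≼ c⊖u≼b)

lemma9p4 : (A : MVAlgebra) → let open MVAlgebra A in
    (kI : X → Sub) → IsK kI → (a u : Carrier) →
    (∀ (x : X) → hat a x × kPreCompl kI u x → ∀ (m : ℕ) → hat (a ⊖ (m · u)) x)
    × (∀ (x : X) → (∀ (m : ℕ) → hat (a ⊖ (m · u)) x) → hat a x × down (kPreCompl kI u) x)
lemma9p4 A kI isK a u = lower , upper
  where
  open MVAlgebra A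
  open Properties A
  open Saturation A u
  open IsLargestAbsorbed

  lower : ∀ x → hat a x × kPreCompl kI u x → ∀ m → hat (a ⊖ (m · u)) x
  lower x (a∉Ix , u∈Ikx) m = a∉Ix ∘′ absorbed-⊖-· (K-absorbed (isK x)) u∈Ikx m

  upper : ∀ x → (∀ m → hat (a ⊖ (m · u)) x) → hat a x × down (kPreCompl kI u) x
  upper (I , isP) a⊖mu∉I = (λ a∈I → a⊖mu∉I 0 (proj₂ (⊆-saturate I a a∈I))) , (s , u∈Iks , ⊆-saturate I)
    where
    isI = IsPrimeLatticeIdeal.isLatticeIdeal isP
    s : X
    s = saturate I , saturate-isPrime isP a (λ { (m , a⊖mu∈I) → a⊖mu∉I m a⊖mu∈I })
    u∈Iks : kPreCompl kI u s
    u∈Iks = K-largest (isK s) (_≼ u) (principal-isLatticeIdeal u) (saturate-absorbs-principal isI) u (≼-refl u)
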